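{- Let $\tau$ be a triangular partition. Every removable cell of $\tau$ is a vertex of $\operatorname{Conv}(\tau)$, and every addable cell of $\tau$ is a vertex of $\operatorname{Conv}(\mathbb{N}^2\setminus\tau)$.
   Context: $\mathbb{N}$ denotes the positive integers. A partition is identified with its Ferrers diagram, a finite subset of $\mathbb{N}^2$ (points called cells). A partition $\tau$ is triangular if there are real $r,s>0$ such that $\tau$ is exactly the set of points of $\mathbb{N}^2$ on or below the line $x/r+y/s=1$. A cell $c\in\tau$ is removable if $\tau\setminus\{c\}$ is a triangular partition; a cell $c\in\mathbb{N}^2\setminus\tau$ is addable if $\tau\cup\{c\}$ is a triangular partition. $\operatorname{Conv}$ denotes convex hull, and "vertex" means a 0-dimensional face of the convex set.
   Formalization: The parameters r, s of a triangular partition are positive rationals rather than reals, and the weights of the convex combinations defining Conv are taken in the rationals. -}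

module Defs where

open import Data.Nat as ℕ using (ℕ)
open import Data.Rational using (ℚ; 0ℚ; 1ℚ; _+_; _*_; _≤_; _<_)
open import Data.Product using (_×_; _,_; Σ; ∃; ∃-syntax; proj₁; proj₂)
open import Data.List using (List; []; _∷_; map)
open import Data.List.Relation.Unary.All using (All)
open import Relation.Nullary using (¬_)
open import Relation.Binary.PropositionalEquality using (_≡_; _≢_)
open import Function.Bundles using (_⇔_)

ι : ℕ → ℚ
ι n = Data.Rational._/_ (Data.Integer.+ n) 1
  where import Data.Integer

-- points of ℕ × ℕ (here ℕ includes 0); cells of the paper live in
-- positive coordinates, enforced by the predicate Pos
Cell : Set
Cell = ℕ × ℕ

Pos : Cell → Set
Pos (x , y) = (1 ℕ.≤ x) × (1 ℕ.≤ y)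

CellSet : Set₁
CellSet = Cell → Set

-- τ is triangular: there are r, s > 0 with
--   τ = { (x,y) ∈ 𝐍² : x/r + y/s ≤ 1 }.
-- Since r, s > 0, x/r + y/s ≤ 1  ⇔  x·s + y·r ≤ r·s.
Triangular : CellSet → Set
Triangular τ =
  Σ ℚ λ r → Σ ℚ λ s → (0ℚ < r) × (0ℚ < s) ×
    (∀ (c : Cell) → τ c ⇔
       (Pos c × (ι (proj₁ c) * s + ι (proj₂ c) * r ≤ r * s)))

sumℚ : List ℚ → ℚ
sumℚ [] = 0ℚ
sumℚ (q ∷ qs) = q + sumℚ qs

_∖₁_ : CellSet → Cell → CellSet
(τ ∖₁ c) d = τ d × d ≢ c

_∪₁_ : CellSet → Cell → CellSet
(τ ∪₁ c) d = Data.Sum._⊎_ (τ d) (d ≡ c)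
  where import Data.Sum

Compl : CellSet → CellSet
Compl τ d = Pos d × ¬ τ d

Removable : CellSet → Cell → Set
Removable τ c = τ c × Triangular (τ ∖₁ c)

Addable : CellSet → Cell → Set
Addable τ c = Pos c × ¬ τ c × Triangular (τ ∪₁ c)

-- c lies in Conv(S ∖ {c}): c is a convex combination (finitely many
-- nonnegative weights summing to 1) of points of S different from c.
InConvWithout : CellSet → Cell → Set
InConvWithout S c =
  ∃[ ws ] (All {A = ℚ × Cell} (λ (wp : ℚ × Cell) →
              (0ℚ ≤ proj₁ wp) × S (proj₂ wp) × proj₂ wp ≢ c) ws
          × sumℚ (map proj₁ ws) ≡ 1ℚ
          × sumℚ (map (λ wp → proj₁ wp * ι (proj₁ (proj₂ wp))) ws) ≡ ι (proj₁ c)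
          × sumℚ (map (λ wp → proj₁ wp * ι (proj₂ (proj₂ wp))) ws) ≡ ι (proj₂ c))

-- c is a vertex (extreme point / 0-dimensional face) of Conv(S),
-- for a lattice point c: c ∈ S and c ∉ Conv(S ∖ {c}).
VertexOfConv : CellSet → Cell → Set
VertexOfConv S c = S c × ¬ InConvWithout S c

-- If τ ∖ {c} (resp. τ ∪ {c}) is triangular with parameters r, s, then the linear
-- form ℓ(x , y) = x·s + y·r is at most r·s on τ ∖ {c} and exceeds r·s at c
-- (resp. is at most r·s at c and exceeds r·s on the rest of ℕ² ∖ τ).  Closed and
-- open half-planes are convex, so in either case c is not a convex combination of
-- the other points.
module Submission where

open import Defs
open import Data.Product using (_×_; _,_; proj₁; proj₂)
open import Data.Rational using (ℚ; 0ℚ; 1ℚ; _+_; _*_; _≤_; _<_; nonNegative; positive)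
open import Data.Rational.Properties
open import Data.Rational.Solver using (module +-*-Solver)
open import Data.List using (List; []; _∷_; map)
open import Data.List.Relation.Unary.All as All using (All; []; _∷_)
open import Data.Sum using ([_,_]′; inj₂)
open import Data.Empty using (⊥-elim)
open import Relation.Binary using (tri<; tri≈; tri>)
open import Relation.Binary.PropositionalEquality
open import Relation.Nullary using (¬_)
open import Function.Bundles using (Equivalence)

totalWeight : {A : Set} → List (ℚ × A) → ℚ
totalWeight ws = sumℚ (map proj₁ ws)

weightedSum : {A : Set} → (A → ℚ) → List (ℚ × A) → ℚ
weightedSum f ws = sumℚ (map (λ wp → proj₁ wp * f (proj₂ wp)) ws)

weightedSum-linear : {A : Set} (f g : A → ℚ) (a b : ℚ) (ws : List (ℚ × A)) →
  weightedSum (λ p → f p * a + g p * b) ws ≡ weightedSum f ws * a + weightedSum g ws * b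
weightedSum-linear f g a b [] = solve 2 (λ a b → con 0ℚ := con 0ℚ :* a :+ con 0ℚ :* b) refl a b
  where open +-*-Solver
weightedSum-linear f g a b ((w , p) ∷ ws) = begin
  w * (f p * a + g p * b) + weightedSum (λ p → f p * a + g p * b) ws
    ≡⟨ cong (w * (f p * a + g p * b) +_) (weightedSum-linear f g a b ws) ⟩
  w * (f p * a + g p * b) + (weightedSum f ws * a + weightedSum g ws * b)
    ≡⟨ distribute w (f p) (g p) (weightedSum f ws) (weightedSum g ws) a b ⟩
  (w * f p + weightedSum f ws) * a + (w * g p + weightedSum g ws) * b ∎
  where
  open ≡-Reasoning
  open +-*-Solver
  distribute : ∀ w x y X Y a b → w * (x * a + y * b) + (X * a + Y * b) ≡ (w * x + X) * a + (w * y + Y) * b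
  distribute = solve 7 (λ w x y X Y a b → w :* (x :* a :+ y :* b) :+ (X :* a :+ Y :* b)
                                       := (w :* x :+ X) :* a :+ (w :* y :+ Y) :* b) refl

weightedSum-≤ : {A : Set} (f : A → ℚ) (K : ℚ) (ws : List (ℚ × A)) →
  All (λ wp → 0ℚ ≤ proj₁ wp × f (proj₂ wp) ≤ K) ws →
  weightedSum f ws ≤ totalWeight ws * K
weightedSum-≤ f K [] [] = ≤-reflexive (sym (*-zeroˡ K))
weightedSum-≤ f K ((w , p) ∷ ws) ((0≤w , fp≤K) ∷ hs) = begin
  w * f p + weightedSum f ws  ≤⟨ +-mono-≤ (*-monoˡ-≤-nonNeg w {{nonNegative 0≤w}} fp≤K) (weightedSum-≤ f K ws hs) ⟩
  w * K + totalWeight ws * K  ≡⟨ *-distribʳ-+ K w (totalWeight ws) ⟨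
  (w + totalWeight ws) * K    ∎
  where open ≤-Reasoning

weightedSum-≥ : {A : Set} (f : A → ℚ) (K : ℚ) (ws : List (ℚ × A)) →
  All (λ wp → 0ℚ ≤ proj₁ wp × K ≤ f (proj₂ wp)) ws →
  totalWeight ws * K ≤ weightedSum f ws
weightedSum-≥ f K [] [] = ≤-reflexive (*-zeroˡ K)
weightedSum-≥ f K ((w , p) ∷ ws) ((0≤w , K≤fp) ∷ hs) = begin
  (w + totalWeight ws) * K    ≡⟨ *-distribʳ-+ K w (totalWeight ws) ⟩
  w * K + totalWeight ws * K  ≤⟨ +-mono-≤ (*-monoˡ-≤-nonNeg w {{nonNegative 0≤w}} K≤fp) (weightedSum-≥ f K ws hs) ⟩
  w * f p + weightedSum f ws  ∎
  where open ≤-Reasoning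

weightedSum-> : {A : Set} (f : A → ℚ) (K : ℚ) (ws : List (ℚ × A)) →
  All (λ wp → 0ℚ ≤ proj₁ wp × K < f (proj₂ wp)) ws → 0ℚ < totalWeight ws →
  totalWeight ws * K < weightedSum f ws
weightedSum-> f K [] [] 0<0 = ⊥-elim (<-irrefl refl 0<0)
weightedSum-> f K ((w , p) ∷ ws) ((0≤w , K<fp) ∷ hs) 0<W with <-cmp 0ℚ w
... | tri< 0<w _ _ = begin-strict
  (w + totalWeight ws) * K    ≡⟨ *-distribʳ-+ K w (totalWeight ws) ⟩
  w * K + totalWeight ws * K  <⟨ +-mono-<-≤ (*-monoʳ-<-pos w {{positive 0<w}} K<fp)
                                   (weightedSum-≥ f K ws (All.map (λ (0≤w , K<f) → 0≤w , <⇒≤ K<f) hs)) ⟩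
  w * f p + weightedSum f ws  ∎
  where open ≤-Reasoning
... | tri≈ _ refl _ = begin-strict
  (0ℚ + totalWeight ws) * K   ≡⟨ cong (_* K) (+-identityˡ (totalWeight ws)) ⟩
  totalWeight ws * K          <⟨ weightedSum-> f K ws hs (subst (0ℚ <_) (+-identityˡ (totalWeight ws)) 0<W) ⟩
  weightedSum f ws            ≡⟨ +-identityˡ (weightedSum f ws) ⟨
  0ℚ + weightedSum f ws       ≡⟨ cong (_+ weightedSum f ws) (*-zeroˡ (f p)) ⟨
  0ℚ * f p + weightedSum f ws ∎
  where open ≤-Reasoning
... | tri> _ _ w<0 = ⊥-elim (<-irrefl refl (<-≤-trans w<0 0≤w))

level : ℚ → ℚ → Cell → ℚ
level r s c = ι (proj₁ c) * s + ι (proj₂ c) * r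

weightedSum-level : (r s : ℚ) (c : Cell) (ws : List (ℚ × Cell)) →
  weightedSum (λ p → ι (proj₁ p)) ws ≡ ι (proj₁ c) →
  weightedSum (λ p → ι (proj₂ p)) ws ≡ ι (proj₂ c) →
  weightedSum (level r s) ws ≡ level r s c
weightedSum-level r s c ws Σx≡x Σy≡y = begin
  weightedSum (level r s) ws
    ≡⟨ weightedSum-linear (λ p → ι (proj₁ p)) (λ p → ι (proj₂ p)) s r ws ⟩
  weightedSum (λ p → ι (proj₁ p)) ws * s + weightedSum (λ p → ι (proj₂ p)) ws * r
    ≡⟨ cong₂ (λ x y → x * s + y * r) Σx≡x Σy≡y ⟩
  level r s c ∎
  where open ≡-Reasoning

InConvWithout-level-≤ : {S : CellSet} {c : Cell} (r s K : ℚ) →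
  (∀ {d} → S d → d ≢ c → level r s d ≤ K) →
  InConvWithout S c → level r s c ≤ K
InConvWithout-level-≤ {c = c} r s K below (ws , hs , Σw≡1 , Σx≡x , Σy≡y) = begin
  level r s c                 ≡⟨ weightedSum-level r s c ws Σx≡x Σy≡y ⟨
  weightedSum (level r s) ws  ≤⟨ weightedSum-≤ (level r s) K ws (All.map (λ (0≤w , Sd , d≢c) → 0≤w , below Sd d≢c) hs) ⟩
  totalWeight ws * K          ≡⟨ cong (_* K) Σw≡1 ⟩
  1ℚ * K                      ≡⟨ *-identityˡ K ⟩
  K                           ∎
  where open ≤-Reasoning

InConvWithout-level-> : {S : CellSet} {c : Cell} (r s K : ℚ) →
  (∀ {d} → S d → d ≢ c → K < level r s d) →
  InConvWithout S c → K < level r s c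
InConvWithout-level-> {c = c} r s K above (ws , hs , Σw≡1 , Σx≡x , Σy≡y) = begin-strict
  K                           ≡⟨ *-identityˡ K ⟨
  1ℚ * K                      ≡⟨ cong (_* K) Σw≡1 ⟨
  totalWeight ws * K          <⟨ weightedSum-> (level r s) K ws (All.map (λ (0≤w , Sd , d≢c) → 0≤w , above Sd d≢c) hs)
                                   (subst (0ℚ <_) (sym Σw≡1) (positive⁻¹ 1ℚ)) ⟩
  weightedSum (level r s) ws  ≡⟨ weightedSum-level r s c ws Σx≡x Σy≡y ⟩
  level r s c                 ∎
  where open ≤-Reasoning

removable⇒vertex : {τ : CellSet} {c : Cell} → Triangular τ → Removable τ c → VertexOfConv τ c
removable⇒vertex {τ} {c} (_ , _ , _ , _ , τ⇔) (τc , r , s , _ , _ , τ∖c⇔) =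
  τc , λ c∈conv → c-outside (InConvWithout-level-≤ r s (r * s) others-inside c∈conv)
  where
  others-inside : ∀ {d} → τ d → d ≢ c → level r s d ≤ r * s
  others-inside τd d≢c = proj₂ (Equivalence.to (τ∖c⇔ _) (τd , d≢c))
  c-outside : ¬ (level r s c ≤ r * s)
  c-outside ℓc≤rs = proj₂ (Equivalence.from (τ∖c⇔ c) (proj₁ (Equivalence.to (τ⇔ c) τc) , ℓc≤rs)) refl

addable⇒vertex : {τ : CellSet} {c : Cell} → Addable τ c → VertexOfConv (Compl τ) c
addable⇒vertex {τ} {c} (pos-c , ¬τc , r , s , _ , _ , τ∪c⇔) =
  (pos-c , ¬τc) , λ c∈conv →
    <-irrefl refl (<-≤-trans (InConvWithout-level-> r s (r * s) others-outside c∈conv) c-inside)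
  where
  others-outside : ∀ {d} → Compl τ d → d ≢ c → r * s < level r s d
  others-outside (pos-d , ¬τd) d≢c =
    ≰⇒> (λ ℓd≤rs → [ ¬τd , d≢c ]′ (Equivalence.from (τ∪c⇔ _) (pos-d , ℓd≤rs)))
  c-inside : level r s c ≤ r * s
  c-inside = proj₂ (Equivalence.to (τ∪c⇔ c) (inj₂ refl))

lemma3p3 : (τ : CellSet) → Triangular τ →
           ((c : Cell) → Removable τ c → VertexOfConv τ c)
           × ((c : Cell) → Addable τ c → VertexOfConv (Compl τ) c)
lemma3p3 τ τ-triangular = (λ c → removable⇒vertex τ-triangular) , (λ c → addable⇒vertex)
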